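{- For every graph $G$, $$\pi(G^{(2)}) \leq 3 \left\lceil \pi(G)^{1/2}\right\rceil .$$
   Context: All graphs are finite, simple and undirected. A path in a graph is a sequence of pairwise distinct vertices, consecutive ones adjacent. Given a vertex colouring $\phi$, a sequence $(v_1,\dots,v_{2s})$ is repetitively coloured if $\phi(v_i)=\phi(v_{s+i})$ for all $i\in\{1,\dots,s\}$; a colouring is nonrepetitive if no path is repetitively coloured. $\pi(G)$ is the minimum number of colours in a nonrepetitive colouring of $G$. $G^{(2)}$ is the $2$-subdivision of $G$, obtained by replacing each edge $vw$ by a path from $v$ to $w$ with exactly two new internal vertices. -}

module Defs where

open import Data.Nat using (ℕ; suc; _+_; _*_; _≤_; _<_)
open import Data.Fin using (Fin)
open import Data.Bool using (Bool; T)
open import Data.Sum using (_⊎_; inj₁; inj₂)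
open import Data.Product using (Σ; _×_; _,_; ∃)
open import Data.List using (List; length; map; take; drop)
open import Data.List.Relation.Unary.Unique.Propositional using (Unique)
open import Data.List.Relation.Binary.Pointwise using (Pointwise)
open import Data.List.Relation.Unary.Linked using (Linked)
open import Relation.Binary.PropositionalEquality using (_≡_)
open import Relation.Nullary using (¬_)
open import Data.Empty using (⊥)
open import Level using (0ℓ)

record Graph : Set₁ where
  field
    Vertex : Set
    Adj    : Vertex → Vertex → Set
open Graph public

record SimpleGraph (n : ℕ) : Set where
  field
    E      : Fin n → Fin n → Bool
    sym    : ∀ u v → T (E u v) → T (E v u)
    irrefl : ∀ u → ¬ T (E u u)
open SimpleGraph public

toGraph : ∀ {n} → SimpleGraph n → Graph
toGraph {n} G = record { Vertex = Fin n ; Adj = λ u v → T (E G u v) }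

-- The edge uw is replaced by the path u - (u,w) - (w,u) - w:
-- the new vertex (u,w) (for an ordered pair with u adjacent to w) is the
-- subdivision vertex of edge uw lying next to u.
SubVertex : ∀ {n} → SimpleGraph n → Set
SubVertex {n} G = Fin n ⊎ Σ (Fin n × Fin n) (λ { (u , w) → T (E G u w) })

data SubAdj {n} (G : SimpleGraph n) : SubVertex G → SubVertex G → Set where
  orig→new : ∀ u w (e : T (E G u w)) → SubAdj G (inj₁ u) (inj₂ ((u , w) , e))
  new→orig : ∀ u w (e : T (E G u w)) → SubAdj G (inj₂ ((u , w) , e)) (inj₁ u)
  new→new  : ∀ u w (e : T (E G u w)) (e' : T (E G w u)) →
             SubAdj G (inj₂ ((u , w) , e)) (inj₂ ((w , u) , e'))

subdivide2 : ∀ {n} → SimpleGraph n → Graph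
subdivide2 G = record { Vertex = SubVertex G ; Adj = SubAdj G }

IsPath : (G : Graph) → List (Vertex G) → Set
IsPath G p = Unique p × Linked (Adj G) p

Repetitive : {V C : Set} → (V → C) → List V → Set
Repetitive φ p = Σ ℕ λ s → (1 ≤ s) × (length p ≡ s + s) ×
                   (map φ (take s p) ≡ map φ (drop s p))

NonRepetitive : (G : Graph) {k : ℕ} → (Vertex G → Fin k) → Set
NonRepetitive G φ = ∀ p → IsPath G p → ¬ Repetitive φ p

HasNRColouring : Graph → ℕ → Set
HasNRColouring G k = Σ (Vertex G → Fin k) (NonRepetitive G)

IsThueNumber : Graph → ℕ → Set
IsThueNumber G k = HasNRColouring G k × (∀ j → j < k → ¬ HasNRColouring G j)

IsCeilSqrt : ℕ → ℕ → Set
IsCeilSqrt k m = (k ≤ m * m) × (∀ j → k ≤ j * j → m ≤ j)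

-- Encode φ(v) injectively as a pair χ(v) = (a , b) ∈ [m]². A branch vertex v
-- (an original vertex of G) gets colour b, a subdivision vertex next to v gets
-- a together with one of two tags, chosen to differ on the two subdivision
-- vertices of an edge: 3m colours.
-- On a path of G⁽²⁾ every branch vertex v is adjacent to a subdivision vertex
-- next to v, so reading the (branch, subdivision) colour pairs forwards, or
-- the (subdivision, branch) pairs backwards, recovers χ along the branch
-- vertices, which form a path of G. If the path is coloured dd, the last and
-- first colours of d belong to adjacent vertices, so one of them is a
-- subdivision colour, and in the corresponding reading nothing is read across
-- the seam of dd: χ along the branch vertices is again a square, contradicting
-- the choice of φ. Paths without branch vertices have at most two vertices,
-- and these carry different tags.
module Submission where

open import Defs hiding (sym)
open import Data.Nat using (ℕ; suc; _+_; _*_; _≤_; s≤s; z≤n)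
open import Data.Nat.Properties using (≮⇒≥)
open import Data.Fin using (Fin; inject≤; remQuot; combine)
  renaming (zero to fzero; suc to fsuc)
open import Data.Fin.Properties using (<-cmp; <-asym; *↔×; inject≤-injective; combine-injective)
  renaming (suc-injective to fsuc-injective)
open import Data.Bool using (T)
open import Data.Bool.Properties using (T-irrelevant)
open import Data.Unit using (⊤; tt)
open import Data.Empty using (⊥)
open import Data.Sum using (inj₁; inj₂)
open import Data.Product using (_×_; _,_; proj₁; proj₂; ∃; ∃₂)
open import Data.Maybe using (Maybe; just; nothing)
open import Data.List using (List; []; _∷_; _++_; length; map; take; drop; fromMaybe)
open import Data.List.Properties
  using (++-assoc; map-++; map-∘; map-injective; length-map; length-++; take-map; drop-map; take++drop≡id; ∷-injectiveˡ; ∷-injectiveʳ)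
open import Data.List.Relation.Unary.All using (All; []; _∷_)
open import Data.List.Relation.Unary.AllPairs using ([]; _∷_)
open import Data.List.Relation.Unary.Linked using (Linked; []; [-]; _∷_)
import Data.List.Relation.Unary.Linked as Linked
import Data.List.Relation.Unary.Linked.Properties as Linkedₚ
open import Data.List.Relation.Unary.Unique.Propositional using (Unique)
open import Function using (_∘_; Injective; Injection)
open import Function.Properties.Inverse using (↔⇒↣)
open import Relation.Binary using (tri<; tri≈; tri>)
open import Relation.Binary.PropositionalEquality
open import Relation.Nullary using (¬_; Dec; yes; no; contradiction)

private
  variable
    A B C : Set
    R : A → A → Set

last⁺ : A → List A → A
last⁺ x []       = x
last⁺ _ (y ∷ ys) = last⁺ y ys

last⁺-++ : ∀ (x : A) xs y ys → last⁺ x (xs ++ y ∷ ys) ≡ last⁺ y ys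
last⁺-++ x []       y ys = refl
last⁺-++ x (z ∷ xs) y ys = last⁺-++ z xs y ys

Linked-seam : ∀ {x : A} xs {y ys} → Linked R ((x ∷ xs) ++ y ∷ ys) → R (last⁺ x xs) y
Linked-seam []       (r ∷ _) = r
Linked-seam (_ ∷ xs) (_ ∷ l) = Linked-seam xs l

mapMaybeAdjacent : (A → A → Maybe B) → List A → List B
mapMaybeAdjacent h (x ∷ y ∷ xs) = fromMaybe (h x y) ++ mapMaybeAdjacent h (y ∷ xs)
mapMaybeAdjacent h _            = []

mapMaybeAdjacent-++ : ∀ (h : A → A → Maybe B) x xs y ys → h (last⁺ x xs) y ≡ nothing →
  mapMaybeAdjacent h ((x ∷ xs) ++ y ∷ ys) ≡ mapMaybeAdjacent h (x ∷ xs) ++ mapMaybeAdjacent h (y ∷ ys)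
mapMaybeAdjacent-++ h x []       y ys seam rewrite seam = refl
mapMaybeAdjacent-++ h x (z ∷ xs) y ys seam =
  trans (cong (fromMaybe (h x z) ++_) (mapMaybeAdjacent-++ h z xs y ys seam))
        (sym (++-assoc (fromMaybe (h x z)) _ _))

take-length-++ : ∀ (xs ys : List A) → take (length xs) (xs ++ ys) ≡ xs
take-length-++ []       ys = refl
take-length-++ (x ∷ xs) ys = cong (x ∷_) (take-length-++ xs ys)

drop-length-++ : ∀ (xs ys : List A) → drop (length xs) (xs ++ ys) ≡ ys
drop-length-++ []       ys = refl
drop-length-++ (x ∷ xs) ys = drop-length-++ xs ys

Square : List A → Set
Square {A} zs = ∃₂ λ (x : A) xs → zs ≡ (x ∷ xs) ++ (x ∷ xs)

mapMaybeAdjacent-Square : ∀ {h : A → A → Maybe B} {zs x xs} → zs ≡ (x ∷ xs) ++ (x ∷ xs) →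
  h (last⁺ x xs) x ≡ nothing →
  mapMaybeAdjacent h zs ≡ mapMaybeAdjacent h (x ∷ xs) ++ mapMaybeAdjacent h (x ∷ xs)
mapMaybeAdjacent-Square {h = h} {x = x} {xs} refl = mapMaybeAdjacent-++ h x xs x xs

Repetitive⇒Square : ∀ {φ : A → C} {p} → Repetitive φ p → Square (map φ p)
Repetitive⇒Square {p = []} (suc s , _ , () , _)
Repetitive⇒Square {φ = φ} {v ∷ p} (suc s , _ , _ , halves) =
  φ v , map φ (take s p) , (begin
    map φ (v ∷ p)                                ≡⟨ cong (map φ) (take++drop≡id (suc s) (v ∷ p)) ⟨
    map φ ((v ∷ take s p) ++ drop s p)           ≡⟨ map-++ φ (v ∷ take s p) (drop s p) ⟩
    map φ (v ∷ take s p) ++ map φ (drop s p)     ≡⟨ cong (map φ (v ∷ take s p) ++_) halves ⟨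
    map φ (v ∷ take s p) ++ map φ (v ∷ take s p) ∎)
  where open ≡-Reasoning

halves⇒Repetitive : ∀ {φ : A → C} {p} e → map φ p ≡ e ++ e → p ≢ [] → Repetitive φ p
halves⇒Repetitive {p = []}    _  _  p≢[] = contradiction refl p≢[]
halves⇒Repetitive {p = _ ∷ _} [] () _
halves⇒Repetitive {φ = φ} {p = p@(_ ∷ _)} e@(_ ∷ _) halves _ =
  length e , s≤s z≤n , p-length , (begin
    map φ (take (length e) p) ≡⟨ take-map (length e) p ⟨
    take (length e) (map φ p) ≡⟨ cong (take (length e)) halves ⟩
    take (length e) (e ++ e)  ≡⟨ take-length-++ e e ⟩
    e                         ≡⟨ drop-length-++ e e ⟨
    drop (length e) (e ++ e)  ≡⟨ cong (drop (length e)) halves ⟨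
    drop (length e) (map φ p) ≡⟨ drop-map (length e) p ⟩
    map φ (drop (length e) p) ∎)
  where
  open ≡-Reasoning
  p-length : length p ≡ length e + length e
  p-length = trans (sym (length-map φ p)) (trans (cong length halves) (length-++ e))

Repetitive-∘⁻ : ∀ {g : B → C} {φ : A → B} {p} → Injective _≡_ _≡_ g → Repetitive (g ∘ φ) p → Repetitive φ p
Repetitive-∘⁻ {p = p} g-inj (s , s≥1 , len , halves) =
  s , s≥1 , len , map-injective g-inj (trans (sym (map-∘ (take s p))) (trans halves (map-∘ (drop s p))))

pairing : ∀ {k m} → k ≤ m * m → Fin k → Fin m × Fin m
pairing {m = m} k≤m*m c = remQuot m (inject≤ c k≤m*m)

pairing-injective : ∀ {k m} (k≤m*m : k ≤ m * m) → Injective _≡_ _≡_ (pairing k≤m*m)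
pairing-injective {m = m} k≤m*m eq =
  inject≤-injective k≤m*m k≤m*m _ _ (Injection.injective (↔⇒↣ (*↔× {m} {m})) eq)

data Colour (A B : Set) : Set where
  branch      : B → Colour A B
  subdivision : Fin 2 → A → Colour A B

subdivision-injectiveˡ : ∀ {t t' : Fin 2} {a a' : A} →
  subdivision {B = B} t a ≡ subdivision t' a' → t ≡ t'
subdivision-injectiveˡ refl = refl

IsBranch : Colour A B → Set
IsBranch (branch _)        = ⊤
IsBranch (subdivision _ _) = ⊥

isBranch? : (c : Colour A B) → Dec (IsBranch c)
isBranch? (branch _)        = yes tt
isBranch? (subdivision _ _) = no λ ()

decodeForward : Colour A B → Colour A B → Maybe (A × B)
decodeForward (branch b) (subdivision _ a) = just (a , b)
decodeForward _          _                 = nothing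

decodeBackward : Colour A B → Colour A B → Maybe (A × B)
decodeBackward c c' = decodeForward c' c

decodeForward-nonbranch : ∀ {c c' : Colour A B} → ¬ IsBranch c → decodeForward c c' ≡ nothing
decodeForward-nonbranch {c = branch _}        c-sub = contradiction tt c-sub
decodeForward-nonbranch {c = subdivision _ _} _     = refl

toFin : ∀ {m} → Colour (Fin m) (Fin m) → Fin (3 * m)
toFin (branch b)        = combine (fzero {2}) b
toFin (subdivision t a) = combine (fsuc t) a

toFin-injective : ∀ {m} → Injective _≡_ _≡_ (toFin {m})
toFin-injective {x = branch b} {branch b'} eq =
  cong branch (proj₂ (combine-injective (fzero {2}) b fzero b' eq))
toFin-injective {x = branch b} {subdivision t' a'} eq
  with () ← proj₁ (combine-injective (fzero {2}) b (fsuc t') a' eq)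
toFin-injective {x = subdivision t a} {branch b'} eq
  with () ← proj₁ (combine-injective (fsuc t) a (fzero {2}) b' eq)
toFin-injective {x = subdivision t a} {subdivision t' a'} eq =
  let t≡t' , a≡a' = combine-injective (fsuc t) a (fsuc t') a' eq
  in cong₂ subdivision (fsuc-injective t≡t') a≡a'

side : ∀ {n} → Fin n → Fin n → Fin 2
side u w with <-cmp u w
... | tri< _ _ _ = fzero
... | tri≈ _ _ _ = fzero
... | tri> _ _ _ = fsuc fzero

side-asym : ∀ {n} {u w : Fin n} → u ≢ w → side u w ≢ side w u
side-asym {u = u} {w} u≢w with <-cmp u w | <-cmp w u
... | tri< u<w _ _ | tri< w<u _ _ = λ _ → <-asym u<w w<u
... | tri> _ _ w<u | tri> _ _ u<w = λ _ → <-asym u<w w<u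
... | tri≈ _ u≡w _ | _            = λ _ → u≢w u≡w
... | _            | tri≈ _ w≡u _ = λ _ → u≢w (sym w≡u)
... | tri< _ _ _   | tri> _ _ _   = λ ()
... | tri> _ _ _   | tri< _ _ _   = λ ()

module _ {n} (G : SimpleGraph n) where

  Edge : Fin n → Fin n → Set
  Edge u w = T (E G u w)

  Edge⇒≢ : ∀ {u w} → Edge u w → u ≢ w
  Edge⇒≢ e refl = irrefl G _ e

  subVertex-irrelevant : ∀ {u w} (e e' : Edge u w) →
    _≡_ {A = SubVertex G} (inj₂ ((u , w) , e)) (inj₂ ((u , w) , e'))
  subVertex-irrelevant e e' = cong (λ e → inj₂ (_ , e)) (T-irrelevant e e')

  branchVertices : List (SubVertex G) → List (Fin n)
  branchVertices []           = []
  branchVertices (inj₁ v ∷ p) = v ∷ branchVertices p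
  branchVertices (inj₂ _ ∷ p) = branchVertices p

  branchVertices-All≢ : ∀ {v} p → All (inj₁ v ≢_) p → All (v ≢_) (branchVertices p)
  branchVertices-All≢ []           []         = []
  branchVertices-All≢ (inj₁ _ ∷ p) (v≢ ∷ v≢p) = (v≢ ∘ cong inj₁) ∷ branchVertices-All≢ p v≢p
  branchVertices-All≢ (inj₂ _ ∷ p) (_ ∷ v≢p)  = branchVertices-All≢ p v≢p

  branchVertices-Unique : ∀ p → Unique p → Unique (branchVertices p)
  branchVertices-Unique []           []            = []
  branchVertices-Unique (inj₁ _ ∷ p) (v∉p ∷ uniq) = branchVertices-All≢ p v∉p ∷ branchVertices-Unique p uniq
  branchVertices-Unique (inj₂ _ ∷ p) (_ ∷ uniq)   = branchVertices-Unique p uniq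

  -- Between consecutive original vertices v, w a path must run through the
  -- edge vw; turning back instead repeats a vertex.
  branchVertices-Linked-from : ∀ v p → Unique (inj₁ v ∷ p) → Linked (SubAdj G) (inj₁ v ∷ p) →
    Linked Edge (v ∷ branchVertices p)
  branchVertices-Linked-from v [] _ _ = [-]
  branchVertices-Linked-from v (_ ∷ []) _ (orig→new _ _ _ ∷ [-]) = [-]
  branchVertices-Linked-from v (_ ∷ _ ∷ _) ((_ ∷ v≢v ∷ _) ∷ _) (orig→new _ _ _ ∷ new→orig _ _ _ ∷ _) =
    contradiction refl v≢v
  branchVertices-Linked-from v (_ ∷ _ ∷ []) _ (orig→new _ _ _ ∷ new→new _ _ _ _ ∷ [-]) = [-]
  branchVertices-Linked-from v (_ ∷ _ ∷ _ ∷ _) (_ ∷ (_ ∷ vw≢vw ∷ _) ∷ _)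
    (orig→new _ _ e ∷ new→new _ _ _ _ ∷ new→new _ _ _ e' ∷ _) =
    contradiction (subVertex-irrelevant e e') vw≢vw
  branchVertices-Linked-from v (_ ∷ _ ∷ _ ∷ p) (_ ∷ _ ∷ _ ∷ uniq)
    (orig→new _ w e ∷ new→new _ _ _ _ ∷ new→orig _ _ _ ∷ linked) =
    e ∷ branchVertices-Linked-from w p uniq linked

  branchVertices-Linked : ∀ p → Unique p → Linked (SubAdj G) p → Linked Edge (branchVertices p)
  branchVertices-Linked []           _          _      = []
  branchVertices-Linked (inj₁ v ∷ p) uniq       linked = branchVertices-Linked-from v p uniq linked
  branchVertices-Linked (inj₂ _ ∷ p) (_ ∷ uniq) linked = branchVertices-Linked p uniq (Linked.tail linked)

  branchVertices-IsPath : ∀ {p} → IsPath (subdivide2 G) p → IsPath (toGraph G) (branchVertices p)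
  branchVertices-IsPath {p} (uniq , linked) = branchVertices-Unique p uniq , branchVertices-Linked p uniq linked

  module _ {A B : Set} (χ : Fin n → A × B) where

    colour : SubVertex G → Colour A B
    colour (inj₁ v)             = branch (proj₂ (χ v))
    colour (inj₂ ((u , w) , _)) = subdivision (side u w) (proj₁ (χ u))

    SubAdj⇒¬bothBranch : ∀ {u w} → SubAdj G u w → ¬ (IsBranch (colour u) × IsBranch (colour w))
    SubAdj⇒¬bothBranch (orig→new _ _ _)   ()
    SubAdj⇒¬bothBranch (new→orig _ _ _)   ()
    SubAdj⇒¬bothBranch (new→new _ _ _ _) ()

    branchVertices-∷ : ∀ {u} p → ¬ IsBranch (colour u) → branchVertices (u ∷ p) ≡ branchVertices p
    branchVertices-∷ {inj₁ _} p u-sub = contradiction tt u-sub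
    branchVertices-∷ {inj₂ _} p _     = refl

    decodeForward-colours : ∀ {u} p → Linked (SubAdj G) (u ∷ p) →
      ¬ IsBranch (last⁺ (colour u) (map colour p)) →
      mapMaybeAdjacent decodeForward (map colour (u ∷ p)) ≡ map χ (branchVertices (u ∷ p))
    decodeForward-colours {inj₁ _} []      _ last-sub = contradiction tt last-sub
    decodeForward-colours {inj₂ _} []      _ _        = refl
    decodeForward-colours {inj₁ v} (_ ∷ p) (orig→new _ _ _ ∷ linked) last-sub =
      cong (χ v ∷_) (decodeForward-colours p linked last-sub)
    decodeForward-colours {inj₂ _} (_ ∷ p) (_ ∷ linked) last-sub =
      decodeForward-colours p linked last-sub

    decodeBackward-colours : ∀ {u} p → Linked (SubAdj G) (u ∷ p) →
      mapMaybeAdjacent decodeBackward (map colour (u ∷ p)) ≡ map χ (branchVertices p)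
    decodeBackward-colours []           _                         = refl
    decodeBackward-colours (inj₁ v ∷ p) (new→orig _ _ _ ∷ linked) = cong (χ v ∷_) (decodeBackward-colours p linked)
    decodeBackward-colours (inj₂ _ ∷ p) (_ ∷ linked)              = decodeBackward-colours p linked

    Square⇒branchHalves : ∀ {p} → IsPath (subdivide2 G) p → Square (map colour p) →
      ∃ λ e → map χ (branchVertices p) ≡ e ++ e
    Square⇒branchHalves {[]} _ (_ , _ , ())
    Square⇒branchHalves {u ∷ p} (_ , linked) (x , xs , sq) with isBranch? (last⁺ x xs)
    ... | no last-sub = mapMaybeAdjacent decodeForward (x ∷ xs) ,
      trans (sym (decodeForward-colours p linked path-last-sub))
            (mapMaybeAdjacent-Square sq (decodeForward-nonbranch last-sub))
      where
      path-last-sub : ¬ IsBranch (last⁺ (colour u) (map colour p))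
      path-last-sub = subst (¬_ ∘ IsBranch)
        (sym (trans (cong₂ last⁺ (∷-injectiveˡ sq) (∷-injectiveʳ sq)) (last⁺-++ x xs x xs))) last-sub
    ... | yes last-branch = mapMaybeAdjacent decodeBackward (x ∷ xs) ,
      trans (cong (map χ) (branchVertices-∷ p first-sub))
            (trans (sym (decodeBackward-colours p linked))
                   (mapMaybeAdjacent-Square sq (decodeForward-nonbranch x-sub)))
      where
      x-sub : ¬ IsBranch x
      x-sub x-branch = Linked-seam xs
        (subst (Linked _) sq (Linkedₚ.map⁺ {R = λ c c' → ¬ (IsBranch c × IsBranch c')}
          (Linked.map SubAdj⇒¬bothBranch linked))) (last-branch , x-branch)
      first-sub : ¬ IsBranch (colour u)
      first-sub = subst (¬_ ∘ IsBranch) (sym (∷-injectiveˡ sq)) x-sub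

    branchVertices-nonempty : ∀ {p} → IsPath (subdivide2 G) p → Square (map colour p) → branchVertices p ≢ []
    branchVertices-nonempty {[]} _ (_ , _ , ())
    branchVertices-nonempty {inj₁ _ ∷ _} _ _ ()
    branchVertices-nonempty {inj₂ _ ∷ []} _ (_ , [] , ())
    branchVertices-nonempty {inj₂ _ ∷ []} _ (_ , _ ∷ _ , ())
    branchVertices-nonempty {inj₂ _ ∷ inj₁ _ ∷ _} _ _ ()
    branchVertices-nonempty {inj₂ _ ∷ inj₂ _ ∷ []} (_ , new→new _ _ e _ ∷ _) (_ , [] , sq) _ =
      side-asym (Edge⇒≢ e) (subdivision-injectiveˡ (trans (∷-injectiveˡ sq) (sym (∷-injectiveˡ (∷-injectiveʳ sq)))))
    branchVertices-nonempty {inj₂ _ ∷ inj₂ _ ∷ []} _ (_ , _ ∷ [] , ())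
    branchVertices-nonempty {inj₂ _ ∷ inj₂ _ ∷ []} _ (_ , _ ∷ _ ∷ _ , ())
    branchVertices-nonempty {inj₂ _ ∷ inj₂ _ ∷ inj₁ _ ∷ _} _ _ ()
    branchVertices-nonempty {inj₂ _ ∷ inj₂ _ ∷ inj₂ _ ∷ _}
      ((_ ∷ uw≢uw ∷ _) ∷ _ , new→new _ _ e _ ∷ new→new _ _ _ e' ∷ _) _ _ =
      uw≢uw (subVertex-irrelevant e e')

subdivide2-NRColouring : ∀ {n} (G : SimpleGraph n) {k m} → k ≤ m * m →
  HasNRColouring (toGraph G) k → HasNRColouring (subdivide2 G) (3 * m)
subdivide2-NRColouring G {k} {m} k≤m*m (φ , φ-nr) = toFin ∘ colour G χ , nonrepetitive
  where
  χ : Fin _ → Fin m × Fin m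
  χ = pairing k≤m*m ∘ φ
  nonrepetitive : NonRepetitive (subdivide2 G) (toFin ∘ colour G χ)
  nonrepetitive p path rep =
    φ-nr (branchVertices G p) (branchVertices-IsPath G path)
      (Repetitive-∘⁻ (pairing-injective {m = m} k≤m*m)
        (halves⇒Repetitive (proj₁ halves) (proj₂ halves) (branchVertices-nonempty G χ path square)))
    where
    square : Square (map (colour G χ) p)
    square = Repetitive⇒Square (Repetitive-∘⁻ toFin-injective rep)
    halves : ∃ λ e → map χ (branchVertices G p) ≡ e ++ e
    halves = Square⇒branchHalves G χ path square

lemma87 : ∀ {n} (G : SimpleGraph n) (k m p : ℕ) →
          IsThueNumber (toGraph G) k → IsCeilSqrt k m →
          IsThueNumber (subdivide2 G) p → p ≤ 3 * m
lemma87 G k m p (G-colouring , _) (k≤m*m , _) (_ , p-minimal) =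
  ≮⇒≥ λ 3m<p → p-minimal (3 * m) 3m<p (subdivide2-NRColouring G {m = m} k≤m*m G-colouring)
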